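{- Let $k\ge2$, $j\in\{1,\dots,k-1\}$, let $\mathcal{G}$ be a $k$-dimensional simplicial complex and let $S$ be the support of a $j$-cocycle of $\mathcal{G}$ (with $\mathbb{F}_2$ coefficients). For each $k$-simplex $K$ of $\mathcal{G}$, let $S_K$ be the set of $j$-simplices in $S$ contained in $K$. Then for each $k$-simplex $K$: (i) either $S_K=\emptyset$, or both $|S_K|\ge k-j+1$ and $\bigcup_{\sigma\in S_K}\sigma=K$; (ii) if $|S_K|=k-j+1$, then $S_K$ forms a $j$-flower in $K$.
   Context: An $i$-simplex is an element of the complex of size $i+1$. A $j$-cocycle is a function $f$ from $j$-simplices to $\mathbb{F}_2$ such that every $(j+1)$-simplex of $\mathcal{G}$ contains an even number of $j$-simplices on which $f$ equals $1$; its support is the set of $j$-simplices mapped to $1$. A collection $\{P_0,\dots,P_{k-j}\}$ of $j$-simplices forms a $j$-flower in the $k$-simplex $K$ if $K=\bigcup_i P_i$ and $|\bigcap_i P_i|=j$. -}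

module Defs where

open import Data.Nat using (ℕ; zero; suc; _≤_; _≡ᵇ_)
open import Data.Nat.Divisibility using (_∣_)
open import Data.Bool using (Bool; true; false; _∧_)
open import Data.Bool.Properties using () renaming (_≟_ to _≟ᵇ_)
open import Data.List using (List; []; _∷_; [_]; map; _++_; filter; length)
open import Data.Fin.Subset using (Subset; inside; outside; _⊆_; ∣_∣; Nonempty; ⋃; ⋂)
open import Data.Fin.Subset.Properties using (_⊆?_)
open import Data.Vec using (_∷_; [])
open import Data.Product using (_×_; ∃)
open import Relation.Nullary using (does)
open import Relation.Binary.PropositionalEquality using (_≡_)

allSubsets : (n : ℕ) → List (Subset n)
allSubsets zero = [ [] ]
allSubsets (suc n) = map (outside ∷_) (allSubsets n) ++ map (inside ∷_) (allSubsets n)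

record Complex (n : ℕ) : Set where
  field
    simplex : Subset n → Bool
    downClosed : ∀ σ τ → simplex σ ≡ true → τ ⊆ σ → Nonempty τ → simplex τ ≡ true
open Complex public

isSimplexᵇ : ∀ {n} → Complex n → ℕ → Subset n → Bool
isSimplexᵇ G i σ = simplex G σ ∧ (∣ σ ∣ ≡ᵇ suc i)

IsSimplex : ∀ {n} → Complex n → ℕ → Subset n → Set
IsSimplex G i σ = isSimplexᵇ G i σ ≡ true

IsDim : ∀ {n} → Complex n → ℕ → Set
IsDim G k = (∀ σ → simplex G σ ≡ true → ∣ σ ∣ ≤ suc k) × ∃ (λ K → IsSimplex G k K)

onesIn : ∀ {n} → Complex n → ℕ → (Subset n → Bool) → Subset n → List (Subset n)
onesIn {n} G j f τ =
  filter (λ σ → (does (σ ⊆? τ) ∧ isSimplexᵇ G j σ ∧ f σ) ≟ᵇ true) (allSubsets n)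

-- f (a function on j-simplices to F₂ = Bool; its values elsewhere are ignored)
-- is a j-cocycle: every (j+1)-simplex contains an even number of j-simplices with f = 1.
IsCocycle : ∀ {n} → Complex n → ℕ → (Subset n → Bool) → Set
IsCocycle G j f = ∀ τ → IsSimplex G (suc j) τ → 2 ∣ length (onesIn G j f τ)

S[_,_,_]_ : ∀ {n} → Complex n → ℕ → (Subset n → Bool) → Subset n → List (Subset n)
S[ G , j , f ] K = onesIn G j f K

IsFlower : ∀ {n} → ℕ → List (Subset n) → Subset n → Set
IsFlower j Ps K = ⋃ Ps ≡ K × ∣ ⋂ Ps ∣ ≡ j

module Submission where

-- Let S_K be the j-simplices of the support S of a j-cocycle f that lie in
-- the k-simplex K, and suppose σ ∈ S_K.  For every vertex v ∈ K ∖ σ the set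
-- σ ∪ {v} is a (j+1)-simplex containing σ; the cocycle condition gives a
-- second face τ_v ∈ S_K of it, and τ_v must contain v ("swap" lemma).  The
-- faces τ_v are pairwise distinct, since v is the only vertex of τ_v outside σ;
-- so σ together with the k−j faces τ_v gives |S_K| ≥ k−j+1, and they cover K.
-- When |S_K| = k−j+1 these are all of S_K (pigeonhole), so τ_w is the only
-- face of S_K containing w ∉ σ.  Put C = σ ∩ τ_{v₀}, a j-set.  For w ≠ v₀,
-- swapping w into τ_{v₀} yields a face of S_K containing w, i.e. τ_w; hence
-- τ_w ⊆ (σ ∪ {w}) ∩ (τ_{v₀} ∪ {w}) = C ∪ {w}, so C ⊆ τ_w.  Thus C ⊆ ⋂ S_K ⊆ C,
-- and S_K is a j-flower.

open import Defs
open import Data.Nat using (ℕ; zero; suc; _≤_; _<_; _+_; _∸_; z≤n; s≤s; _≤?_)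
open import Data.Nat.Properties
  using ( ≤-trans; ≤-reflexive; ≤-antisym; ≤-pred; <⇒≱; ≰⇒>; n≮n; 0≢1+n; m+n∸n≡m; m<n⇒0<n∸m
        ; +-suc; ≡ᵇ⇒≡; ≡⇒≡ᵇ; module ≤-Reasoning)
open import Data.Nat.Divisibility using (_∣_; ∣1⇒≡1)
open import Data.Bool using (Bool; true; _∧_)
open import Data.Bool.Properties using (T-≡) renaming (_≟_ to _≟ᵇ_)
open import Data.Fin using (Fin; zero; suc; _≟_)
open import Data.Fin.Properties using (suc-injective)
open import Data.Fin.Subset hiding (⊥)
open import Data.Fin.Subset.Properties
open import Data.Vec using ([]; _∷_; here; there)
open import Data.Vec.Properties using (≡-dec; ∷-injectiveʳ)
open import Data.List using (List; []; _∷_; length; map)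
open import Data.List.Properties using (length-map; length-removeAt′)
open import Data.List.Membership.Propositional using ()
  renaming (_∈_ to _∈ˡ_)
open import Data.List.Membership.Propositional.Properties
  using (∈-map⁺; ∈-map⁻; ∈-++⁺ˡ; ∈-++⁺ʳ; ∈-filter⁺; ∈-filter⁻)
open import Data.List.Relation.Binary.Subset.Propositional using () renaming (_⊆_ to _⊆ˡ_)
open import Data.List.Relation.Unary.Any using (here; there; index; any?) renaming (_─_ to _─ˡ_)
open import Data.List.Relation.Unary.All using ([]; _∷_; tabulate)
import Data.List.Relation.Unary.All as All
open import Data.List.Relation.Unary.All.Properties using (¬Any⇒All¬) renaming (map⁺ to All-map⁺)
open import Data.List.Relation.Unary.AllPairs using ([]; _∷_)
open import Data.List.Relation.Unary.Unique.Propositional using (Unique)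
import Data.List.Relation.Unary.Unique.Propositional.Properties as Unique
open import Data.Product using (_×_; _,_; ∃; proj₁; proj₂)
open import Data.Sum using (_⊎_; inj₁; inj₂; [_,_]; map₂)
open import Data.Empty using (⊥-elim)
open import Relation.Nullary using (¬_; Dec; yes; no; does; contradiction)
open import Relation.Nullary.Decidable using (dec-true)
open import Relation.Binary.Definitions using (DecidableEquality)
open import Relation.Binary.PropositionalEquality
  using (_≡_; _≢_; refl; sym; trans; cong; subst; ≢-sym; module ≡-Reasoning)
open import Function.Bundles using (Equivalence)

module _ {A : Set} where

  ∈-─ : ∀ {x z : A} {ys} (x∈ys : x ∈ˡ ys) → z ∈ˡ ys → z ≢ x → z ∈ˡ (ys ─ˡ x∈ys)
  ∈-─ (here refl) (here refl) z≢x = ⊥-elim (z≢x refl)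
  ∈-─ (here refl) (there z∈ys) _  = z∈ys
  ∈-─ (there _)   (here refl) _   = here refl
  ∈-─ (there x∈ys) (there z∈ys) z≢x = there (∈-─ x∈ys z∈ys z≢x)

  unique-⊆⇒length≤ : ∀ {xs ys : List A} → Unique xs → xs ⊆ˡ ys → length xs ≤ length ys
  unique-⊆⇒length≤ {[]} _ _ = z≤n
  unique-⊆⇒length≤ {x ∷ xs} {ys} (x∉xs ∷ xs-unique) xs⊆ys =
    ≤-trans (s≤s (unique-⊆⇒length≤ xs-unique xs⊆ys─x))
            (≤-reflexive (sym (length-removeAt′ ys (index x∈ys))))
    where
    x∈ys : x ∈ˡ ys
    x∈ys = xs⊆ys (here refl)
    xs⊆ys─x : xs ⊆ˡ (ys ─ˡ x∈ys)
    xs⊆ys─x z∈xs = ∈-─ x∈ys (xs⊆ys (there z∈xs)) (≢-sym (All.lookup x∉xs z∈xs))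

  unique-⊆-tight⇒⊇ : DecidableEquality A → ∀ {xs ys : List A} → Unique xs → xs ⊆ˡ ys →
                     length ys ≤ length xs → ys ⊆ˡ xs
  unique-⊆-tight⇒⊇ _≟ₐ_ {xs} {ys} xs-unique xs⊆ys ys≤xs {y} y∈ys with any? (y ≟ₐ_) xs
  ... | yes y∈xs = y∈xs
  ... | no  y∉xs = contradiction (≤-trans longer ys≤xs) (n≮n (length xs))
    where
    y∷xs⊆ys : (y ∷ xs) ⊆ˡ ys
    y∷xs⊆ys (here refl) = y∈ys
    y∷xs⊆ys (there z∈xs) = xs⊆ys z∈xs
    longer : suc (length xs) ≤ length ys
    longer = unique-⊆⇒length≤ (¬Any⇒All¬ xs y∉xs ∷ xs-unique) y∷xs⊆ys

  even-unique⇒companion : ∀ {T : List A} {x} → Unique T → 2 ∣ length T → x ∈ˡ T →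
                          ∃ λ y → y ∈ˡ T × y ≢ x
  even-unique⇒companion {a ∷ []} _ 2∣1 _ = contradiction (∣1⇒≡1 2∣1) λ ()
  even-unique⇒companion {a ∷ b ∷ _} ((a≢b ∷ _) ∷ _) _ (here refl) =
    b , there (here refl) , ≢-sym a≢b
  even-unique⇒companion {a ∷ b ∷ _} (a∉ ∷ _) _ (there x∈) = a , here refl , All.lookup a∉ x∈

  map-unique : ∀ {B : Set} (g : A → B) {xs} →
               (∀ {x y} → x ∈ˡ xs → y ∈ˡ xs → g x ≡ g y → x ≡ y) → Unique xs → Unique (map g xs)
  map-unique g _ [] = []
  map-unique g injective (x∉xs ∷ xs-unique) =
    All-map⁺ (tabulate λ y∈xs gx≡gy → All.lookup x∉xs y∈xs (injective (here refl) (there y∈xs) gx≡gy))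
    ∷ map-unique g (λ x∈ y∈ → injective (there x∈) (there y∈)) xs-unique

  []-or-member : (xs : List A) → xs ≡ [] ⊎ ∃ (_∈ˡ xs)
  []-or-member []      = inj₁ refl
  []-or-member (x ∷ _) = inj₂ (x , here refl)

∣∪⁅⁆∣ : ∀ {n} {p : Subset n} {v} → v ∉ p → ∣ p ∪ ⁅ v ⁆ ∣ ≡ suc ∣ p ∣
∣∪⁅⁆∣ {p = inside ∷ p}  {zero}  v∉p = contradiction here v∉p
∣∪⁅⁆∣ {p = outside ∷ p} {zero}  _   = cong (λ q → suc ∣ q ∣) (∪-identityʳ p)
∣∪⁅⁆∣ {p = inside ∷ p}  {suc v} v∉p = cong suc (∣∪⁅⁆∣ (λ v∈p → v∉p (there v∈p)))
∣∪⁅⁆∣ {p = outside ∷ p} {suc v} v∉p = ∣∪⁅⁆∣ (λ v∈p → v∉p (there v∈p))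

∣─∣+∣∣ : ∀ {n} {K s : Subset n} → s ⊆ K → ∣ K ─ s ∣ + ∣ s ∣ ≡ ∣ K ∣
∣─∣+∣∣ {K = []} {[]} _ = refl
∣─∣+∣∣ {K = a ∷ K} {inside ∷ s} s⊆K with s⊆K here
... | here = trans (+-suc ∣ K ─ s ∣ ∣ s ∣) (cong suc (∣─∣+∣∣ (drop-∷-⊆ s⊆K)))
∣─∣+∣∣ {K = inside ∷ K}  {outside ∷ s} s⊆K = cong suc (∣─∣+∣∣ (drop-∷-⊆ s⊆K))
∣─∣+∣∣ {K = outside ∷ K} {outside ∷ s} s⊆K = ∣─∣+∣∣ (drop-∷-⊆ s⊆K)

x∈p─q⇒x∉q : ∀ {n} {p q : Subset n} {x} → x ∈ p ─ q → x ∉ q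
x∈p─q⇒x∉q {p = a ∷ p} {inside ∷ q} () here
x∈p─q⇒x∉q {p = a ∷ p} {b ∷ q} (there x∈) (there x∈q) = x∈p─q⇒x∉q {p = p} {q} x∈ x∈q

module _ {n : ℕ} where

  ∈-∪⁅⁆⁻ : ∀ {p : Subset n} {v x} → x ∈ p ∪ ⁅ v ⁆ → x ∈ p ⊎ x ≡ v
  ∈-∪⁅⁆⁻ {p} {v} x∈ = map₂ (x∈⁅y⁆⇒x≡y v) (x∈p∪q⁻ p ⁅ v ⁆ x∈)

  v∈∪⁅v⁆ : ∀ {p : Subset n} {v} → v ∈ p ∪ ⁅ v ⁆
  v∈∪⁅v⁆ {p} {v} = q⊆p∪q p ⁅ v ⁆ (x∈⁅x⁆ v)

  ⊆∪⁅⁆-new≡ : ∀ {τ p : Subset n} {v x} → τ ⊆ p ∪ ⁅ v ⁆ → x ∈ τ → x ∉ p → x ≡ v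
  ⊆∪⁅⁆-new≡ τ⊆ x∈τ x∉p = [ (λ x∈p → contradiction x∈p x∉p) , (λ x≡v → x≡v) ] (∈-∪⁅⁆⁻ (τ⊆ x∈τ))

  ⊆∪⁅⁆-∌⇒⊆ : ∀ {τ p : Subset n} {v} → τ ⊆ p ∪ ⁅ v ⁆ → v ∉ τ → τ ⊆ p
  ⊆∪⁅⁆-∌⇒⊆ τ⊆ v∉τ x∈τ = [ (λ x∈p → x∈p) , (λ { refl → contradiction x∈τ v∉τ }) ] (∈-∪⁅⁆⁻ (τ⊆ x∈τ))

  ⊆∪⁅⁆-∩ : ∀ {τ p q : Subset n} {v} → τ ⊆ p ∪ ⁅ v ⁆ → τ ⊆ q ∪ ⁅ v ⁆ → τ ⊆ (p ∩ q) ∪ ⁅ v ⁆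
  ⊆∪⁅⁆-∩ τ⊆p τ⊆q x∈τ with ∈-∪⁅⁆⁻ (τ⊆p x∈τ) | ∈-∪⁅⁆⁻ (τ⊆q x∈τ)
  ... | inj₁ x∈p | inj₁ x∈q = p⊆p∪q _ (x∈p∩q⁺ (x∈p , x∈q))
  ... | inj₂ refl | _        = v∈∪⁅v⁆
  ... | inj₁ _   | inj₂ refl = v∈∪⁅v⁆

  ⊆-card⇒⊇ : ∀ {p q : Subset n} → p ⊆ q → ∣ q ∣ ≤ ∣ p ∣ → q ⊆ p
  ⊆-card⇒⊇ {p} p⊆q q≤p {x} x∈q with x ∈? p
  ... | yes x∈p = x∈p
  ... | no  x∉p = contradiction q≤p (<⇒≱ (p⊂q⇒∣p∣<∣q∣ (p⊆q , x , x∈q , x∉p)))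

  ⊆-card⇒≡ : ∀ {p q : Subset n} → p ⊆ q → ∣ p ∣ ≡ ∣ q ∣ → p ≡ q
  ⊆-card⇒≡ p⊆q p≡q = ⊆-antisym p⊆q (⊆-card⇒⊇ p⊆q (≤-reflexive (sym p≡q)))

  ⊆-⊉⇒card< : ∀ {p q : Subset n} → p ⊆ q → ¬ (q ⊆ p) → ∣ p ∣ < ∣ q ∣
  ⊆-⊉⇒card< {p} {q} p⊆q q⊈p with ∣ q ∣ ≤? ∣ p ∣
  ... | yes q≤p = ⊥-elim (q⊈p (⊆-card⇒⊇ p⊆q q≤p))
  ... | no  q≰p = ≰⇒> q≰p

  swap-∩-card : ∀ {σ τ : Subset n} {v j} → τ ⊆ σ ∪ ⁅ v ⁆ → v ∈ τ → v ∉ σ →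
                ∣ τ ∣ ≡ suc j → ∣ σ ∣ ≡ suc j → ∣ σ ∩ τ ∣ ≡ j
  swap-∩-card {σ} {τ} {v} {j} τ⊆ v∈τ v∉σ ∣τ∣ ∣σ∣ = ≤-antisym at-most at-least
    where
    σ⊈σ∩τ : ¬ (σ ⊆ σ ∩ τ)
    σ⊈σ∩τ σ⊆ = v∉σ (⊆-card⇒⊇ (λ x∈σ → p∩q⊆q σ τ (σ⊆ x∈σ)) (≤-reflexive (trans ∣τ∣ (sym ∣σ∣))) v∈τ)
    at-most : ∣ σ ∩ τ ∣ ≤ j
    at-most = ≤-pred (subst (∣ σ ∩ τ ∣ <_) ∣σ∣ (⊆-⊉⇒card< (p∩q⊆p σ τ) σ⊈σ∩τ))
    at-least : j ≤ ∣ σ ∩ τ ∣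
    at-least = ≤-pred (begin
      suc j                   ≡⟨ sym ∣τ∣ ⟩
      ∣ τ ∣                   ≤⟨ p⊆q⇒∣p∣≤∣q∣ (⊆∪⁅⁆-∩ τ⊆ (p⊆p∪q ⁅ v ⁆)) ⟩
      ∣ (σ ∩ τ) ∪ ⁅ v ⁆ ∣    ≡⟨ ∣∪⁅⁆∣ (λ v∈ → v∉σ (p∩q⊆p σ τ v∈)) ⟩
      suc ∣ σ ∩ τ ∣           ∎)
      where open ≤-Reasoning

  0<card⇒nonempty : ∀ {p : Subset n} → 0 < ∣ p ∣ → Nonempty p
  0<card⇒nonempty {p} 0<∣p∣ with nonempty? p
  ... | yes ne = ne
  ... | no ¬ne = contradiction (trans (cong ∣_∣ (Empty-unique ¬ne)) (∣⊥∣≡0 n)) λ ∣p∣≡0 →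
                   n≮n 0 (subst (0 <_) ∣p∣≡0 0<∣p∣)

  ∈-⋃⁺ : ∀ {ps : List (Subset n)} {p x} → p ∈ˡ ps → x ∈ p → x ∈ ⋃ ps
  ∈-⋃⁺ {q ∷ ps} (here refl) x∈p = p⊆p∪q (⋃ ps) x∈p
  ∈-⋃⁺ {q ∷ ps} (there p∈)  x∈p = q⊆p∪q q (⋃ ps) (∈-⋃⁺ p∈ x∈p)

  ⋃-⊆ : ∀ {ps : List (Subset n)} {K} → (∀ {p} → p ∈ˡ ps → p ⊆ K) → ⋃ ps ⊆ K
  ⋃-⊆ {[]}     _   x∈ = contradiction x∈ ∉⊥
  ⋃-⊆ {q ∷ ps} ps⊆ x∈ = [ ps⊆ (here refl) , ⋃-⊆ (λ p∈ → ps⊆ (there p∈)) ] (x∈p∪q⁻ q (⋃ ps) x∈)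

  ⋂-⊆ : ∀ {ps : List (Subset n)} {p} → p ∈ˡ ps → ⋂ ps ⊆ p
  ⋂-⊆ {q ∷ ps} (here refl) x∈ = p∩q⊆p q (⋂ ps) x∈
  ⋂-⊆ {q ∷ ps} (there p∈)  x∈ = ⋂-⊆ p∈ (p∩q⊆q q (⋂ ps) x∈)

  ⊆-⋂ : ∀ {ps : List (Subset n)} {C} → (∀ {p} → p ∈ˡ ps → C ⊆ p) → C ⊆ ⋂ ps
  ⊆-⋂ {[]}     _   _  = ∈⊤
  ⊆-⋂ {q ∷ ps} ⊆ps x∈ = x∈p∩q⁺ (⊆ps (here refl) x∈ , ⊆-⋂ (λ p∈ → ⊆ps (there p∈)) x∈)

elements : ∀ {n} → Subset n → List (Fin n)
elements []            = []
elements (inside ∷ p)  = zero ∷ map suc (elements p)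
elements (outside ∷ p) = map suc (elements p)

length-elements : ∀ {n} (p : Subset n) → length (elements p) ≡ ∣ p ∣
length-elements []            = refl
length-elements (inside ∷ p)  = cong suc (trans (length-map suc (elements p)) (length-elements p))
length-elements (outside ∷ p) = trans (length-map suc (elements p)) (length-elements p)

elements-unique : ∀ {n} (p : Subset n) → Unique (elements p)
elements-unique []            = []
elements-unique (inside ∷ p)  =
  All-map⁺ (tabulate λ _ ()) ∷ Unique.map⁺ suc-injective (elements-unique p)
elements-unique (outside ∷ p) = Unique.map⁺ suc-injective (elements-unique p)

∈-elements⁺ : ∀ {n} (p : Subset n) {x} → x ∈ p → x ∈ˡ elements p
∈-elements⁺ (inside ∷ p)  here       = here refl
∈-elements⁺ (inside ∷ p)  (there x∈) = there (∈-map⁺ suc (∈-elements⁺ p x∈))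
∈-elements⁺ (outside ∷ p) (there x∈) = ∈-map⁺ suc (∈-elements⁺ p x∈)

∈-elements⁻ : ∀ {n} (p : Subset n) {x} → x ∈ˡ elements p → x ∈ p
∈-elements⁻ (inside ∷ p) (here refl) = here
∈-elements⁻ (inside ∷ p) (there x∈) with ∈-map⁻ suc x∈
... | y , y∈ , refl = there (∈-elements⁻ p y∈)
∈-elements⁻ (outside ∷ p) x∈ with ∈-map⁻ suc x∈
... | y , y∈ , refl = there (∈-elements⁻ p y∈)

∈-allSubsets : ∀ {n} (p : Subset n) → p ∈ˡ allSubsets n
∈-allSubsets []                      = here refl
∈-allSubsets {suc n} (outside ∷ p) = ∈-++⁺ˡ (∈-map⁺ (outside ∷_) (∈-allSubsets p))
∈-allSubsets {suc n} (inside ∷ p)  =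
  ∈-++⁺ʳ (map (outside ∷_) (allSubsets n)) (∈-map⁺ (inside ∷_) (∈-allSubsets p))

allSubsets-unique : ∀ n → Unique (allSubsets n)
allSubsets-unique zero    = [] ∷ []
allSubsets-unique (suc n) =
  Unique.++⁺ (Unique.map⁺ ∷-injectiveʳ (allSubsets-unique n))
             (Unique.map⁺ ∷-injectiveʳ (allSubsets-unique n)) disjoint
  where
  disjoint : ∀ {v} → ¬ (v ∈ˡ map (outside ∷_) (allSubsets n) × v ∈ˡ map (inside ∷_) (allSubsets n))
  disjoint (out , in′) with ∈-map⁻ (outside ∷_) out | ∈-map⁻ (inside ∷_) in′
  ... | _ , _ , refl | _ , _ , ()

∧≡true⁻ : ∀ {a b : Bool} → a ∧ b ≡ true → a ≡ true × b ≡ true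
∧≡true⁻ {true} {true} _ = refl , refl

does≡true⁻ : ∀ {P : Set} (P? : Dec P) → does P? ≡ true → P
does≡true⁻ (yes p) _ = p

module _ {n : ℕ} (G : Complex n) where

  isSimplex⁻ : ∀ {i σ} → IsSimplex G i σ → simplex G σ ≡ true × ∣ σ ∣ ≡ suc i
  isSimplex⁻ {i} {σ} σ-simplex =
    let in-G , size = ∧≡true⁻ σ-simplex
    in in-G , ≡ᵇ⇒≡ ∣ σ ∣ (suc i) (Equivalence.from T-≡ size)

  isSimplex⁺ : ∀ {i σ} → simplex G σ ≡ true → ∣ σ ∣ ≡ suc i → IsSimplex G i σ
  isSimplex⁺ {i} {σ} in-G size rewrite in-G =
    Equivalence.to T-≡ (≡⇒≡ᵇ ∣ σ ∣ (suc i) size)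

  SupportFace : ℕ → (Subset n → Bool) → Subset n → Subset n → Set
  SupportFace j f τ σ = σ ⊆ τ × IsSimplex G j σ × f σ ≡ true

  module _ (j : ℕ) (f : Subset n → Bool) (τ : Subset n) where

    private
      test? : ∀ σ → Dec ((does (σ ⊆? τ) ∧ isSimplexᵇ G j σ ∧ f σ) ≡ true)
      test? σ = (does (σ ⊆? τ) ∧ isSimplexᵇ G j σ ∧ f σ) ≟ᵇ true

    onesIn⁻ : ∀ {σ} → σ ∈ˡ onesIn G j f τ → SupportFace j f τ σ
    onesIn⁻ {σ} σ∈ =
      let σ⊆τ , rest = ∧≡true⁻ {does (σ ⊆? τ)} (proj₂ (∈-filter⁻ test? {xs = allSubsets n} σ∈))
          σ-simplex , fσ = ∧≡true⁻ {isSimplexᵇ G j σ} rest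
      in does≡true⁻ (σ ⊆? τ) σ⊆τ , σ-simplex , fσ

    onesIn⁺ : ∀ {σ} → SupportFace j f τ σ → σ ∈ˡ onesIn G j f τ
    onesIn⁺ {σ} (σ⊆τ , σ-simplex , fσ) = ∈-filter⁺ test? (∈-allSubsets σ) holds
      where
      holds : (does (σ ⊆? τ) ∧ isSimplexᵇ G j σ ∧ f σ) ≡ true
      holds rewrite dec-true (σ ⊆? τ) σ⊆τ | σ-simplex = fσ

    onesIn-unique : Unique (onesIn G j f τ)
    onesIn-unique = Unique.filter⁺ test? (allSubsets-unique n)

module InSimplex {n : ℕ} (k j : ℕ) (G : Complex n) (f : Subset n → Bool)
               (cocycle : IsCocycle G j f) (K : Subset n) (K-simplex : IsSimplex G k K) where

  S : List (Subset n)
  S = S[ G , j , f ] K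

  S⊆K : ∀ {τ} → τ ∈ˡ S → τ ⊆ K
  S⊆K τ∈S = proj₁ (onesIn⁻ G j f K τ∈S)

  S-card : ∀ {τ} → τ ∈ˡ S → ∣ τ ∣ ≡ suc j
  S-card τ∈S = proj₂ (isSimplex⁻ G (proj₁ (proj₂ (onesIn⁻ G j f K τ∈S))))

  record Swap (b : Subset n) (v : Fin n) (τ : Subset n) : Set where
    field
      member : τ ∈ˡ S
      ⊆b∪v   : τ ⊆ b ∪ ⁅ v ⁆
      ∋v     : v ∈ τ
  open Swap public

  other-face∋v : ∀ {b τ v} → b ∈ˡ S → τ ∈ˡ S → τ ⊆ b ∪ ⁅ v ⁆ → τ ≢ b → v ∈ τ
  other-face∋v {b} {τ} {v} b∈S τ∈S τ⊆ τ≢b with v ∈? τ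
  ... | yes v∈τ = v∈τ
  ... | no  v∉τ = contradiction (⊆-card⇒≡ (⊆∪⁅⁆-∌⇒⊆ τ⊆ v∉τ) (trans (S-card τ∈S) (sym (S-card b∈S)))) τ≢b

  -- The cocycle condition on the (j+1)-simplex b ∪ {v} ⊆ K.
  swap : ∀ {b v} → b ∈ˡ S → v ∈ K → v ∉ b → ∃ (Swap b v)
  swap {b} {v} b∈S v∈K v∉b =
    let τ , τ∈ρ , τ≢b = even-unique⇒companion (onesIn-unique G j f ρ) (cocycle ρ ρ-simplex) b∈ρ
        τ⊆ρ , τ-simplex , fτ = onesIn⁻ G j f ρ τ∈ρ
        τ∈S = onesIn⁺ G j f K ((λ x∈τ → ρ⊆K (τ⊆ρ x∈τ)) , τ-simplex , fτ)
    in τ , record { member = τ∈S ; ⊆b∪v = τ⊆ρ ; ∋v = other-face∋v b∈S τ∈S τ⊆ρ τ≢b }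
    where
    ρ : Subset n
    ρ = b ∪ ⁅ v ⁆
    ρ⊆K : ρ ⊆ K
    ρ⊆K x∈ρ = [ S⊆K b∈S , (λ { refl → v∈K }) ] (∈-∪⁅⁆⁻ x∈ρ)
    ρ-simplex : IsSimplex G (suc j) ρ
    ρ-simplex = isSimplex⁺ G (downClosed G K ρ (proj₁ (isSimplex⁻ G K-simplex)) ρ⊆K (v , v∈∪⁅v⁆))
                             (trans (∣∪⁅⁆∣ v∉b) (cong suc (S-card b∈S)))
    b∈ρ : b ∈ˡ onesIn G j f ρ
    b∈ρ = let _ , b-simplex , fb = onesIn⁻ G j f K b∈S in onesIn⁺ G j f ρ (p⊆p∪q ⁅ v ⁆ , b-simplex , fb)

  module Around {σ : Subset n} (σ∈S : σ ∈ˡ S) where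

    newVertices : List (Fin n)
    newVertices = elements (K ─ σ)

    newVertex⁻ : ∀ {v} → v ∈ˡ newVertices → v ∈ K × v ∉ σ
    newVertex⁻ v∈ = let v∈K─σ = ∈-elements⁻ (K ─ σ) v∈ in p─q⊆p K σ v∈K─σ , x∈p─q⇒x∉q {p = K} {σ} v∈K─σ

    length-newVertices : length newVertices ≡ k ∸ j
    length-newVertices = begin
      length newVertices          ≡⟨ length-elements (K ─ σ) ⟩
      ∣ K ─ σ ∣                   ≡⟨ sym (m+n∸n≡m ∣ K ─ σ ∣ (suc j)) ⟩
      ∣ K ─ σ ∣ + suc j ∸ suc j   ≡⟨ cong (λ m → ∣ K ─ σ ∣ + m ∸ suc j) (sym (S-card σ∈S)) ⟩
      ∣ K ─ σ ∣ + ∣ σ ∣ ∸ suc j   ≡⟨ cong (_∸ suc j) (∣─∣+∣∣ (S⊆K σ∈S)) ⟩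
      ∣ K ∣ ∸ suc j               ≡⟨ cong (_∸ suc j) (proj₂ (isSimplex⁻ G K-simplex)) ⟩
      k ∸ j                       ∎
      where open ≡-Reasoning

    swap-into-σ : ∀ {v} → v ∈ K ─ σ → ∃ (Swap σ v)
    swap-into-σ v∈K─σ = swap σ∈S (p─q⊆p K σ v∈K─σ) (x∈p─q⇒x∉q {p = K} {σ} v∈K─σ)

    -- τ_v: a chosen face of S swapping v into σ (σ itself when v ∉ K ∖ σ).  Making
    -- it a total function of v means a vertex determines its face.
    newFace : Fin n → Subset n
    newFace v with v ∈? K ─ σ
    ... | yes v∈K─σ = proj₁ (swap-into-σ v∈K─σ)
    ... | no  _     = σ

    newFace-swap : ∀ {v} → v ∈ˡ newVertices → Swap σ v (newFace v)
    newFace-swap {v} v∈ with v ∈? K ─ σ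
    ... | yes v∈K─σ = proj₂ (swap-into-σ v∈K─σ)
    ... | no  v∉K─σ = contradiction (∈-elements⁻ (K ─ σ) v∈) v∉K─σ

    newFace-new≡ : ∀ {v w} → v ∈ˡ newVertices → w ∈ newFace v → w ∉ σ → w ≡ v
    newFace-new≡ v∈ = ⊆∪⁅⁆-new≡ (⊆b∪v (newFace-swap v∈))

    faces : List (Subset n)
    faces = σ ∷ map newFace newVertices

    faces-unique : Unique faces
    faces-unique = All-map⁺ (tabulate σ≢τ_v) ∷ map-unique newFace injective (elements-unique (K ─ σ))
      where
      σ≢τ_v : ∀ {v} → v ∈ˡ newVertices → σ ≢ newFace v
      σ≢τ_v v∈ σ≡τ_v = proj₂ (newVertex⁻ v∈) (subst (_ ∈_) (sym σ≡τ_v) (∋v (newFace-swap v∈)))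
      injective : ∀ {v w} → v ∈ˡ newVertices → w ∈ˡ newVertices → newFace v ≡ newFace w → v ≡ w
      injective v∈ w∈ τ_v≡τ_w =
        newFace-new≡ w∈ (subst (_ ∈_) τ_v≡τ_w (∋v (newFace-swap v∈))) (proj₂ (newVertex⁻ v∈))

    faces⊆S : faces ⊆ˡ S
    faces⊆S (here refl) = σ∈S
    faces⊆S (there τ∈)  with ∈-map⁻ newFace τ∈
    ... | v , v∈ , refl = member (newFace-swap v∈)

    length-faces : length faces ≡ suc (k ∸ j)
    length-faces = cong suc (trans (length-map newFace newVertices) length-newVertices)

    lower-bound : suc (k ∸ j) ≤ length S
    lower-bound = subst (_≤ length S) length-faces (unique-⊆⇒length≤ faces-unique faces⊆S)

    -- Every vertex of K lies in σ or in τ_v.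
    union : ⋃ S ≡ K
    union = ⊆-antisym (⋃-⊆ S⊆K) covered
      where
      covered : K ⊆ ⋃ S
      covered {x} x∈K with x ∈? σ
      ... | yes x∈σ = ∈-⋃⁺ σ∈S x∈σ
      ... | no  x∉σ = let x∈ = ∈-elements⁺ (K ─ σ) (x∈p∧x∉q⇒x∈p─q x∈K x∉σ)
                      in ∈-⋃⁺ (member (newFace-swap x∈)) (∋v (newFace-swap x∈))

    module Tight (tight : length S ≡ suc (k ∸ j)) (j<k : j < k) where

      S⊆faces : S ⊆ˡ faces
      S⊆faces = unique-⊆-tight⇒⊇ (≡-dec _≟ᵇ_) faces-unique faces⊆S
                                  (≤-reflexive (trans tight (sym length-faces)))

      newFace-only : ∀ {τ w} → τ ∈ˡ S → w ∈ τ → w ∉ σ → τ ≡ newFace w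
      newFace-only τ∈S w∈τ w∉σ with S⊆faces τ∈S
      ... | here refl = contradiction w∈τ w∉σ
      ... | there τ∈  with ∈-map⁻ newFace τ∈
      ... | u , u∈ , refl = cong newFace (sym (newFace-new≡ u∈ w∈τ w∉σ))

      K─σ-nonempty : Nonempty (K ─ σ)
      K─σ-nonempty = 0<card⇒nonempty
        (subst (0 <_) (trans (sym length-newVertices) (length-elements (K ─ σ))) (m<n⇒0<n∸m j<k))

      v₀ : Fin n
      v₀ = proj₁ K─σ-nonempty

      v₀∈ : v₀ ∈ˡ newVertices
      v₀∈ = ∈-elements⁺ (K ─ σ) (proj₂ K─σ-nonempty)

      τ₀ : Subset n
      τ₀ = newFace v₀

      τ₀-swap : Swap σ v₀ τ₀
      τ₀-swap = newFace-swap v₀∈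

      core : Subset n
      core = σ ∩ τ₀

      core-card : ∣ core ∣ ≡ j
      core-card = swap-∩-card (⊆b∪v τ₀-swap) (∋v τ₀-swap) (proj₂ (newVertex⁻ v₀∈))
                              (S-card (member τ₀-swap)) (S-card σ∈S)

      -- Swapping w into τ₀ gives τ_w, so τ_w ⊆ core ∪ {w} and hence τ_w = core ∪ {w}.
      core⊆newFace : ∀ {w} → w ∈ˡ newVertices → core ⊆ newFace w
      core⊆newFace {w} w∈ with w ≟ v₀
      ... | yes refl = p∩q⊆q σ τ₀
      ... | no  w≢v₀ = λ x∈core → core∪w⊆τ_w (p⊆p∪q ⁅ w ⁆ x∈core)
        where
        w∉σ : w ∉ σ
        w∉σ = proj₂ (newVertex⁻ w∈)
        w∉τ₀ : w ∉ τ₀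
        w∉τ₀ w∈τ₀ = w≢v₀ (newFace-new≡ v₀∈ w∈τ₀ w∉σ)
        τ′-swap : ∃ (Swap τ₀ w)
        τ′-swap = swap (member τ₀-swap) (proj₁ (newVertex⁻ w∈)) w∉τ₀
        τ_w⊆τ₀∪w : newFace w ⊆ τ₀ ∪ ⁅ w ⁆
        τ_w⊆τ₀∪w = subst (_⊆ τ₀ ∪ ⁅ w ⁆)
                         (newFace-only (member (proj₂ τ′-swap)) (∋v (proj₂ τ′-swap)) w∉σ)
                         (⊆b∪v (proj₂ τ′-swap))
        core∪w⊆τ_w : core ∪ ⁅ w ⁆ ⊆ newFace w
        core∪w⊆τ_w = ⊆-card⇒⊇ (⊆∪⁅⁆-∩ (⊆b∪v (newFace-swap w∈)) τ_w⊆τ₀∪w)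
                       (≤-reflexive (trans (∣∪⁅⁆∣ (λ w∈core → w∉σ (p∩q⊆p σ τ₀ w∈core)))
                                    (trans (cong suc core-card) (sym (S-card (member (newFace-swap w∈)))))))

      core⊆S : ∀ {τ} → τ ∈ˡ S → core ⊆ τ
      core⊆S τ∈S with S⊆faces τ∈S
      ... | here refl = p∩q⊆p σ τ₀
      ... | there τ∈  with ∈-map⁻ newFace τ∈
      ... | w , w∈ , refl = core⊆newFace w∈

      ⋂S≡core : ⋂ S ≡ core
      ⋂S≡core = ⊆-antisym (λ x∈ → x∈p∩q⁺ (⋂-⊆ σ∈S x∈ , ⋂-⊆ (member τ₀-swap) x∈)) (⊆-⋂ core⊆S)

      flower : IsFlower j S K
      flower = union , trans (cong ∣_∣ ⋂S≡core) core-card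

lemma3p1 : ∀ {n} (k j : ℕ) → 2 ≤ k → 1 ≤ j → j < k →
    (G : Complex n) → IsDim G k →
    (f : Subset n → Bool) → IsCocycle G j f →
    (K : Subset n) → IsSimplex G k K →
    ((S[ G , j , f ] K ≡ [])
       ⊎ (suc (k ∸ j) ≤ length (S[ G , j , f ] K) × ⋃ (S[ G , j , f ] K) ≡ K))
    × (length (S[ G , j , f ] K) ≡ suc (k ∸ j) → IsFlower j (S[ G , j , f ] K) K)
lemma3p1 k j _ _ j<k G _ f cocycle K K-simplex with []-or-member (S[ G , j , f ] K)
... | inj₁ S≡[] = inj₁ S≡[] , λ tight → contradiction (trans (sym (cong length S≡[])) tight) 0≢1+n
... | inj₂ (σ , σ∈S) = inj₂ (lower-bound , union) , λ tight → Tight.flower tight j<k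
  where open InSimplex.Around k j G f cocycle K K-simplex σ∈S
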